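{- Let $n \in \mathbb{N}^*$, let $k \geq 2$ be an integer, let $a, b \in \mathbb{F}_{2^n}$ with $a \neq 0$, and let $c, d \in \overline{\mathbb{F}_{2^n}}$ be such that for every $x \in \mathbf{P}^1(\mathbb{F}_{2^n})$ one has $\theta_{c,d}^{k/2}(x) = \theta_{a,b,k}(x)$ if $k$ is even, and $\theta_{c,d}^{k}(x) = \theta_{a,b,k}^2(x)$ if $k$ is odd. Define $\psi$ on $\mathbf{P}^1(\mathbb{F}_{2^n})$ by $\psi := \theta_{a,b,k}$ if $k$ is even and $\psi := \theta_{a,b,k}^2$ if $k$ is odd, and let $m := k/2$ if $k$ is even and $m := k$ if $k$ is odd. For $x_0 \in \mathbf{P}^1(\mathbb{F}_{2^n})$ let $$l_1 := |O(\theta_{c,d}, x_0)|,\quad l_2 := |O(\theta_{a,b,k}, x_0)|,\quad l_3 := |O(\psi, x_0)|.$$ Then $l_3 = \frac{l_1}{\gcd(l_1, m)}$. Moreover $l_2 = l_3$ if $k$ is even, while $l_2 \in \{l_3, 2 l_3\}$ if $k$ is odd.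
   Context: $\overline{\mathbb{F}_{2^n}}$ is an algebraic closure of $\mathbb{F}_{2^n}$ and $\mathbf{P}^1(F) = F \cup \{\infty\}$. $\theta_{a,b,k}(x) = a x^{2^k} + b$ for $x \in \mathbb{F}_{2^n}$, $\theta_{a,b,k}(\infty) = \infty$. $\theta_{c,d}(x) = c x^4 + d$ for $x \in \overline{\mathbb{F}_{2^n}}$, $\theta_{c,d}(\infty) = \infty$. Powers of maps denote iterated composition. For a map $f$ and a point $x_0$, $O(f, x_0) := \{f^i(x_0) : i \geq 0\}$ is the orbit of $x_0$ and $|O(f,x_0)|$ its cardinality. -}

module Defs where

open import Level using (Level; _⊔_; suc)
open import Algebra.Bundles using (CommutativeRing)
open import Data.Nat using (ℕ; zero; suc; _<_; _≤_; _%_; _/_; _^_)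
open import Data.Fin using (Fin)
open import Data.List using (List; []; _∷_; _++_; [_]; length)
open import Data.List.Relation.Unary.All using (All)
open import Data.Maybe using (Maybe; just; nothing)
open import Data.Product using (_×_; ∃; Σ; _,_)
open import Data.Unit.Polymorphic using (⊤)
open import Data.Empty.Polymorphic using (⊥)
open import Relation.Nullary using (¬_)
open import Relation.Binary.PropositionalEquality using (_≡_)

iter : ∀ {a} {A : Set a} → (A → A) → ℕ → A → A
iter f zero    x = x
iter f (suc i) x = f (iter f i x)

module _ {o ℓ} (K : CommutativeRing o ℓ) where
  open CommutativeRing K

  IsField : Set (o ⊔ ℓ)
  IsField = ¬ (1# ≈ 0#) × (∀ x → ¬ (x ≈ 0#) → ∃ λ y → x * y ≈ 1#)

  CharTwo : Set ℓ
  CharTwo = 1# + 1# ≈ 0#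

  pow : Carrier → ℕ → Carrier
  pow x zero    = 1#
  pow x (suc e) = x * pow x e

  -- polynomial given by its coefficient list (constant term first)
  eval : List Carrier → Carrier → Carrier
  eval []       x = 0#
  eval (a ∷ as) x = a + x * eval as x

  -- the monic polynomial x^d + a_{d-1} x^{d-1} + ... + a_0, where as = a_0 … a_{d-1}
  evalMonic : List Carrier → Carrier → Carrier
  evalMonic as x = eval (as ++ [ 1# ]) x

  AlgClosed : Set (o ⊔ ℓ)
  AlgClosed = ∀ (as : List Carrier) → 1 ≤ length as → ∃ λ x → evalMonic as x ≈ 0#

  IsSubfield : ∀ {p} → (Carrier → Set p) → Set (o ⊔ ℓ ⊔ p)
  IsSubfield P =
      (∀ {x y} → x ≈ y → P x → P y)
    × P 0# × P 1#
    × (∀ {x y} → P x → P y → P (x + y))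
    × (∀ {x y} → P x → P y → P (x * y))
    × (∀ {x} → P x → P (- x))
    × (∀ {x y} → P x → x * y ≈ 1# → P y)

  AlgebraicOver : ∀ {p} → (Carrier → Set p) → Set (o ⊔ ℓ ⊔ p)
  AlgebraicOver P = ∀ x → ∃ λ (as : List Carrier) →
    All P as × 1 ≤ length as × evalMonic as x ≈ 0#

  HasCard : ∀ {p} → (Carrier → Set p) → ℕ → Set (o ⊔ ℓ ⊔ p)
  HasCard P N = Σ (Fin N → Carrier) λ e →
      (∀ i → P (e i))
    × (∀ i j → e i ≈ e j → i ≡ j)
    × (∀ x → P x → ∃ λ i → x ≈ e i)

  IsAlgClosureOfF2n : ∀ {p} → (Carrier → Set p) → ℕ → Set (o ⊔ ℓ ⊔ p)
  IsAlgClosureOfF2n P n =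
    IsField × CharTwo × IsSubfield P × HasCard P (2 ^ n) × AlgClosed × AlgebraicOver P

  -- projective line P^1(K) = K ∪ {∞}, with ∞ = nothing
  P1 : Set o
  P1 = Maybe Carrier

  _≈P_ : P1 → P1 → Set ℓ
  nothing ≈P nothing = ⊤
  just x  ≈P just y  = x ≈ y
  _       ≈P _       = ⊥

  InP1 : ∀ {p} → (Carrier → Set p) → P1 → Set p
  InP1 P nothing  = ⊤
  InP1 P (just x) = P x

  θ : Carrier → Carrier → ℕ → P1 → P1
  θ a b e nothing  = nothing
  θ a b e (just x) = just (a * pow x e + b)

  θabk : Carrier → Carrier → ℕ → P1 → P1
  θabk a b k = θ a b (2 ^ k)

  θcd : Carrier → Carrier → P1 → P1
  θcd c d = θ c d 4

  ψ : Carrier → Carrier → ℕ → P1 → P1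
  ψ a b k = aux (k % 2)
    where
    aux : ℕ → P1 → P1
    aux zero    = θabk a b k
    aux (suc _) = iter (θabk a b k) 2

  OrbitCard : (P1 → P1) → P1 → ℕ → Set ℓ
  OrbitCard f x0 l =
      (∀ i j → i < l → j < l → iter f i x0 ≈P iter f j x0 → i ≡ j)
    × (∀ i → ∃ λ j → j < l × iter f i x0 ≈P iter f j x0)

mOf : ℕ → ℕ
mOf k = aux (k % 2)
  where
  aux : ℕ → ℕ
  aux zero    = k / 2
  aux (suc _) = k

module Submission where

-- The core is a fact about orbits of a map f on any setoid: if f has an
-- orbit of size l through x₀ and x₀ lies on a cycle of length l' of f^m
-- (m > 0), then the f-orbit is a cycle too, f^t x₀ ≈ x₀ exactly when l ∣ t,
-- and (f^m)^t x₀ ≈ x₀ exactly when l' ∣ t; hence l' ∣ t ⇔ l ∣ t·m, which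
-- forces l = l'·gcd(l, m)  (orbitSize-of-power, via gcd-from-divisibility).
-- The algebra feeding it: over a field of characteristic 2 the map
-- x ↦ a x^{2^k} + b (a ≠ 0) keeps distinct points distinct (Frobenius is
-- injective), so the ψ-orbit of x₀ is a cycle; and ψ maps P¹(F) into itself,
-- so the hypothesis θ_{c,d}^m = ψ on P¹(F) makes the ψ-orbit of x₀ also its
-- θ_{c,d}^m-orbit.  Finally f = θ_{c,d} gives l₁ = l₃·gcd(l₁, m);
-- for k even ψ = θ_{a,b,k} gives l₂ = l₃; for k odd, f = θ_{a,b,k} and m = 2
-- give l₂ = l₃·gcd(l₂, 2) ∈ {l₃, 2·l₃}.

open import Defs
open import Level using (_⊔_)
open import Algebra.Bundles using (CommutativeRing)
import Data.Nat as ℕ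
import Data.Nat.Properties as ℕₚ
open import Data.Nat using (ℕ; zero; suc; _<_; _≤_; _%_; _/_; _^_; s≤s; z≤n; NonZero; >-nonZero; >-nonZero⁻¹)
open import Data.Nat.DivMod using (m≡m%n+[m/n]*n; m%n<n; m≥n⇒m/n>0)
open import Data.Nat.Divisibility using (_∣_; divides; ∣-refl; ∣-antisym; n∣m*n; *-monoˡ-∣; m%n≡0⇒n∣m; ∣⇒≤; 0∣⇒≡0)
open import Data.Nat.GCD using (gcd; gcd-greatest; gcd[m,n]∣m; gcd[m,n]∣n; c*gcd[m,n]≡gcd[cm,cn])
open import Data.Product using (_×_; _,_; ∃; proj₁; proj₂)
open import Data.Sum using (_⊎_; inj₁; inj₂)
open import Data.Maybe using (just; nothing)
open import Data.Unit.Polymorphic using (tt)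
open import Data.Empty using (⊥-elim)
open import Relation.Nullary using (¬_)
open import Relation.Binary using (Setoid; tri<; tri≈; tri>)
open import Relation.Binary.PropositionalEquality as ≡ using (_≡_; cong; subst; subst₂; module ≡-Reasoning)
import Relation.Binary.Reasoning.Setoid as SetoidReasoning
import Algebra.Properties.CommutativeSemigroup as CommSemigroupProperties
import Algebra.Properties.Group as GroupProperties

module ProjectiveLine {o ℓ} (K : CommutativeRing o ℓ) where
  open CommutativeRing K

  P1-setoid : Setoid o ℓ
  P1-setoid = record
    { Carrier       = P1 K
    ; _≈_           = _≈P_ K
    ; isEquivalence = record
      { refl  = λ {x} → reflP {x}
      ; sym   = λ {x} {y} → symP {x} {y}
      ; trans = λ {x} {y} {z} → transP {x} {y} {z}
      }
    }
    where
    reflP : ∀ {x} → _≈P_ K x x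
    reflP {nothing} = tt
    reflP {just x}  = refl
    symP : ∀ {x y} → _≈P_ K x y → _≈P_ K y x
    symP {nothing} {nothing} _   = tt
    symP {just x}  {just y}  x≈y = sym x≈y
    transP : ∀ {x y z} → _≈P_ K x y → _≈P_ K y z → _≈P_ K x z
    transP {nothing} {nothing} {nothing} _   _   = tt
    transP {just x}  {just y}  {just z}  x≈y y≈z = trans x≈y y≈z

  pow-cong : ∀ {x y} e → x ≈ y → pow K x e ≈ pow K y e
  pow-cong zero    _   = refl
  pow-cong (suc e) x≈y = *-cong x≈y (pow-cong e x≈y)

  pow-+ : ∀ x m n → pow K x (m ℕ.+ n) ≈ pow K x m * pow K x n
  pow-+ x zero    n = sym (*-identityˡ _)
  pow-+ x (suc m) n = trans (*-congˡ (pow-+ x m n)) (sym (*-assoc _ _ _))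

  pow-2^suc : ∀ x k → pow K x (2 ^ suc k) ≈ pow K x (2 ^ k) * pow K x (2 ^ k)
  pow-2^suc x k = trans (reflexive (cong (λ t → pow K x (2 ^ k ℕ.+ t)) (ℕₚ.+-identityʳ (2 ^ k))))
                        (pow-+ x (2 ^ k) (2 ^ k))

  θ-cong : ∀ a b e x y → _≈P_ K x y → _≈P_ K (θ K a b e x) (θ K a b e y)
  θ-cong a b e nothing  nothing  _   = tt
  θ-cong a b e (just x) (just y) x≈y = +-congʳ (*-congˡ (pow-cong e x≈y))

  θ-preserves : ∀ {p} {F : Carrier → Set p} → IsSubfield K F →
                ∀ {a b} e → F a → F b → ∀ x → InP1 K F x → InP1 K F (θ K a b e x)
  θ-preserves _ e Fa Fb nothing _ = tt
  θ-preserves {F = F} (_ , _ , F-one , F-+ , F-* , _) e Fa Fb (just x) Fx = F-+ (F-* Fa (pow-preserves e)) Fb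
    where
    pow-preserves : ∀ e → F (pow K x e)
    pow-preserves zero    = F-one
    pow-preserves (suc e) = F-* Fx (pow-preserves e)

module CharTwoField {o ℓ} (K : CommutativeRing o ℓ) (isField : IsField K) (char2 : CharTwo K) where
  open CommutativeRing K
  open SetoidReasoning setoid
  open GroupProperties +-group using (∙-cancelʳ)
  open CommSemigroupProperties *-commutativeSemigroup using (interchange)
  open ProjectiveLine K using (pow-2^suc)

  double≈0 : ∀ z → z + z ≈ 0#
  double≈0 z = begin
    z + z             ≈⟨ +-cong (*-identityˡ z) (*-identityˡ z) ⟨
    1# * z + 1# * z   ≈⟨ distribʳ z 1# 1# ⟨
    (1# + 1#) * z     ≈⟨ *-congʳ char2 ⟩
    0# * z            ≈⟨ zeroˡ z ⟩
    0#                ∎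

  frobenius-+ : ∀ x y → (x + y) * (x + y) ≈ x * x + y * y
  frobenius-+ x y = begin
    (x + y) * (x + y)                   ≈⟨ distribʳ (x + y) x y ⟩
    x * (x + y) + y * (x + y)           ≈⟨ +-cong (distribˡ x x y) (distribˡ y x y) ⟩
    (x * x + x * y) + (y * x + y * y)   ≈⟨ +-congˡ (+-congʳ (*-comm y x)) ⟩
    (x * x + x * y) + (x * y + y * y)   ≈⟨ +-assoc _ _ _ ⟩
    x * x + (x * y + (x * y + y * y))   ≈⟨ +-congˡ (+-assoc _ _ _) ⟨
    x * x + ((x * y + x * y) + y * y)   ≈⟨ +-congˡ (+-congʳ (double≈0 (x * y))) ⟩
    x * x + (0# + y * y)                ≈⟨ +-congˡ (+-identityˡ _) ⟩
    x * x + y * y                       ∎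

  sum≈0⇒≈ : ∀ x y → x + y ≈ 0# → x ≈ y
  sum≈0⇒≈ x y x+y≈0 = ∙-cancelʳ y x y (trans x+y≈0 (sym (double≈0 y)))

  square-nonzero : ∀ z → ¬ z ≈ 0# → ¬ z * z ≈ 0#
  square-nonzero z z≉0 zz≈0 with proj₂ isField z z≉0
  ... | w , zw≈1 = proj₁ isField (begin
    1#                  ≈⟨ *-identityˡ 1# ⟨
    1# * 1#             ≈⟨ *-cong zw≈1 zw≈1 ⟨
    (z * w) * (z * w)   ≈⟨ interchange z w z w ⟩
    (z * z) * (w * w)   ≈⟨ *-congʳ zz≈0 ⟩
    0# * (w * w)        ≈⟨ zeroˡ _ ⟩
    0#                  ∎)

  -- Squaring is injective: x² = y² gives (x + y)² = 0, so x + y = 0 and x = y.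
  square-separates : ∀ x y → ¬ x ≈ y → ¬ x * x ≈ y * y
  square-separates x y x≉y xx≈yy =
    square-nonzero (x + y) (λ x+y≈0 → x≉y (sum≈0⇒≈ x y x+y≈0))
      (trans (frobenius-+ x y) (trans (+-congʳ xx≈yy) (double≈0 (y * y))))

  pow-2^k-separates : ∀ k x y → ¬ x ≈ y → ¬ pow K x (2 ^ k) ≈ pow K y (2 ^ k)
  pow-2^k-separates zero    x y x≉y e = x≉y (trans (sym (*-identityʳ x)) (trans e (*-identityʳ y)))
  pow-2^k-separates (suc k) x y x≉y e =
    square-separates _ _ (pow-2^k-separates k x y x≉y) (trans (sym (pow-2^suc x k)) (trans e (pow-2^suc y k)))

  affine-cancel : ∀ a b u v → ¬ a ≈ 0# → a * u + b ≈ a * v + b → u ≈ v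
  affine-cancel a b u v a≉0 e with proj₂ isField a a≉0
  ... | w , aw≈1 = begin
    u              ≈⟨ *-identityˡ u ⟨
    1# * u         ≈⟨ *-congʳ wa≈1 ⟨
    (w * a) * u    ≈⟨ *-assoc _ _ _ ⟩
    w * (a * u)    ≈⟨ *-congˡ (∙-cancelʳ b _ _ e) ⟩
    w * (a * v)    ≈⟨ *-assoc _ _ _ ⟨
    (w * a) * v    ≈⟨ *-congʳ wa≈1 ⟩
    1# * v         ≈⟨ *-identityˡ v ⟩
    v              ∎
    where
    wa≈1 : w * a ≈ 1#
    wa≈1 = trans (*-comm w a) aw≈1

  θabk-separates : ∀ a b k → ¬ a ≈ 0# → ∀ x y → ¬ _≈P_ K x y → ¬ _≈P_ K (θabk K a b k x) (θabk K a b k y)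
  θabk-separates a b k a≉0 nothing  nothing  x≉y _ = x≉y tt
  θabk-separates a b k a≉0 (just x) (just y) x≉y e =
    pow-2^k-separates k x y x≉y (affine-cancel a b _ _ a≉0 e)

-- Natural-number arithmetic is opened only here, after the ring-valued modules,
-- so that it does not clash with the ring operations opened there.
open import Data.Nat using (_+_; _*_)
open import Data.Nat.Properties using (+-suc; +-comm; *-identityʳ; *-comm; <-cmp; <-trans; <⇒≢; n<1+n; ≤-trans; m*n≢0; *-commutativeSemigroup)

iter-+ : ∀ {a} {A : Set a} (f : A → A) m n x → iter f (m + n) x ≡ iter f m (iter f n x)
iter-+ f zero    n x = ≡.refl
iter-+ f (suc m) n x = cong f (iter-+ f m n x)

iter-* : ∀ {a} {A : Set a} (f : A → A) m i x → iter (iter f m) i x ≡ iter f (i * m) x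
iter-* f m zero    x = ≡.refl
iter-* f m (suc i) x = ≡.trans (cong (iter f m) (iter-* f m i x)) (≡.sym (iter-+ f m (i * m) x))

iter-≗ : ∀ {a} {A : Set a} {f g : A → A} → (∀ x → f x ≡ g x) → ∀ i x → iter f i x ≡ iter g i x
iter-≗ f≗g zero    x = ≡.refl
iter-≗ {f = f} f≗g (suc i) x = ≡.trans (cong f (iter-≗ f≗g i x)) (f≗g _)

gcd-from-divisibility : ∀ l l' m → (∀ t → l' ∣ t → l ∣ t * m) → (∀ t → l ∣ t * m → l' ∣ t) →
                        l ≡ l' * gcd l m
gcd-from-divisibility l l' m to from = ∣-antisym l∣l'g l'g∣l
  where
  -- l divides l'·l and (as l' ∣ l') also l'·m, hence gcd(l'·l, l'·m) = l'·gcd(l, m)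
  l∣l'g : l ∣ l' * gcd l m
  l∣l'g = subst (l ∣_) (≡.sym (c*gcd[m,n]≡gcd[cm,cn] l' l m))
                (gcd-greatest (n∣m*n l') (to l' ∣-refl))
  -- writing l = u·g and m = v·g, the number u satisfies l ∣ u·m, hence l' ∣ u
  l'g∣l : l' * gcd l m ∣ l
  l'g∣l with gcd[m,n]∣m l m | gcd[m,n]∣n l m
  ... | divides u l≡ug | divides v m≡vg =
    subst (l' * gcd l m ∣_) (≡.sym l≡ug) (*-monoˡ-∣ (gcd l m) (from u l∣um))
    where
    open CommSemigroupProperties *-commutativeSemigroup using (x∙yz≈y∙xz)
    l∣um : l ∣ u * m
    l∣um = divides v (begin
      u * m             ≡⟨ cong (u *_) m≡vg ⟩
      u * (v * gcd l m) ≡⟨ x∙yz≈y∙xz u v (gcd l m) ⟩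
      v * (u * gcd l m) ≡⟨ cong (v *_) (≡.sym l≡ug) ⟩
      v * l             ∎)
      where open ≡-Reasoning

-- gcd(l, 2) is 1 or 2, so l = l'·gcd(l, 2) means l = l' or l = 2·l'.
gcd-with-2 : ∀ l l' → l ≡ l' * gcd l 2 → l ≡ l' ⊎ l ≡ 2 * l'
gcd-with-2 l l' eq with gcd l 2 | gcd[m,n]∣n l 2
... | 0                 | g∣2 with () ← 0∣⇒≡0 g∣2
... | 1                 | _   = inj₁ (≡.trans eq (*-identityʳ l'))
... | 2                 | _   = inj₂ (≡.trans eq (*-comm l' 2))
... | suc (suc (suc _)) | g∣2 with s≤s (s≤s ()) ← ∣⇒≤ g∣2

module Orbits {c ℓ} (S : Setoid c ℓ) where
  open Setoid S

  -- |O(f, x₀)| = l : f^0 x₀, …, f^{l-1} x₀ are pairwise distinct and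
  -- every iterate equals one of them (this is OrbitCard for S = P¹(K)).
  OrbitSize : (Carrier → Carrier) → Carrier → ℕ → Set ℓ
  OrbitSize f x₀ l =
      (∀ i j → i < l → j < l → iter f i x₀ ≈ iter f j x₀ → i ≡ j)
    × (∀ i → ∃ λ j → j < l × iter f i x₀ ≈ iter f j x₀)

  IsCycle : (Carrier → Carrier) → Carrier → ℕ → Set ℓ
  IsCycle f x₀ l = OrbitSize f x₀ l × iter f l x₀ ≈ x₀

  -- f keeps distinct points of its orbit through x₀ distinct
  -- (stated negatively: the field facts behind it are negative).
  SeparatesOrbit : (Carrier → Carrier) → Carrier → Set ℓ
  SeparatesOrbit f x₀ = ∀ i j → ¬ iter f i x₀ ≈ iter f j x₀ → ¬ iter f (suc i) x₀ ≈ iter f (suc j) x₀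

  -- f respects ≈ (with explicit points, so that it can be supplied for
  -- relations such as _≈P_ that are defined by pattern matching)
  Respects≈ : (Carrier → Carrier) → Set (c ⊔ ℓ)
  Respects≈ f = ∀ x y → x ≈ y → f x ≈ f y

  iter-cong : ∀ {f} → Respects≈ f → ∀ i → Respects≈ (iter f i)
  iter-cong f-cong zero    x y x≈y = x≈y
  iter-cong f-cong (suc i) x y x≈y = f-cong _ _ (iter-cong f-cong i x y x≈y)

  orbitSize-positive : ∀ {f x₀ l} → OrbitSize f x₀ l → 0 < l
  orbitSize-positive {l = zero} (_ , covers) with covers 0
  ... | _ , () , _
  orbitSize-positive {l = suc _} _ = s≤s z≤n

  orbitSize-unique : ∀ {f x₀ l l'} → OrbitSize f x₀ l → OrbitSize f x₀ l' → l ≡ l'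
  orbitSize-unique {l = l} {l'} (distinct , covers) (distinct' , covers') with <-cmp l l'
  ... | tri≈ _ l≡l' _ = l≡l'
  ... | tri< l<l' _ _ with covers l
  ...   | j , j<l , e = ⊥-elim (<⇒≢ j<l (≡.sym (distinct' l j l<l' (<-trans j<l l<l') e)))
  orbitSize-unique {l' = l'} (distinct , covers) (distinct' , covers') | tri> _ _ l'<l with covers' l'
  ...   | j , j<l' , e = ⊥-elim (<⇒≢ j<l' (≡.sym (distinct _ j l'<l (<-trans j<l' l'<l) e)))

  orbitSize-transport : ∀ {f g x y l} → (∀ i → iter f i x ≈ iter g i y) → OrbitSize f x l → OrbitSize g y l
  orbitSize-transport same (distinct , covers) =
      (λ i j i<l j<l e → distinct i j i<l j<l (trans (same i) (trans e (sym (same j)))))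
    , (λ i → let (j , j<l , e) = covers i in j , j<l , trans (sym (same i)) (trans e (same j)))

  cycle-transport : ∀ {f g x y l} → (∀ i → iter f i x ≈ iter g i y) → IsCycle f x l → IsCycle g y l
  cycle-transport {l = l} same (orbit , closes) =
    orbitSize-transport same orbit , trans (sym (same l)) (trans closes (same 0))

  iterates-agree : ∀ {p} {P : Carrier → Set p} {f g x₀} → Respects≈ g →
                   (∀ x → P x → P (f x)) → (∀ x → P x → g x ≈ f x) → P x₀ →
                   ∀ i → iter f i x₀ ≈ iter g i x₀
  iterates-agree {P = P} {f} {g} {x₀} g-cong f-preserves g≈f Px₀ i = proj₂ (go i)
    where
    go : ∀ i → P (iter f i x₀) × iter f i x₀ ≈ iter g i x₀
    go zero    = Px₀ , refl
    go (suc i) = let (P-fi , fi≈gi) = go i in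
      f-preserves _ P-fi , trans (sym (g≈f _ P-fi)) (g-cong _ _ fi≈gi)

  separating-orbit-closes : ∀ {f x₀ l} → SeparatesOrbit f x₀ → OrbitSize f x₀ l → iter f l x₀ ≈ x₀
  separating-orbit-closes {l = zero} _ (_ , covers) with covers 0
  ... | _ , () , _
  separating-orbit-closes {l = suc l} separates (distinct , covers) with covers (suc l)
  ... | zero  , _          , e = e
  ... | suc j , s≤s j<l , e =
    ⊥-elim (separates l j (λ e' → <⇒≢ j<l (≡.sym (distinct l j (n<1+n l) (<-trans j<l (n<1+n l)) e'))) e)

  -- If some positive iterate fixes x₀, then f^i x₀ ≈ f^{N-1}(f^{i+1} x₀),
  -- so f is injective along the orbit of x₀.
  returning-orbit-separates : ∀ {f x₀ N} → Respects≈ f → 0 < N → iter f N x₀ ≈ x₀ → SeparatesOrbit f x₀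
  returning-orbit-separates {f} {x₀} {suc N'} f-cong _ returns i j i≉j e =
    i≉j (trans (shift i) (trans (iter-cong f-cong N' _ _ e) (sym (shift j))))
    where
    shift : ∀ i → iter f i x₀ ≈ iter f N' (iter f (suc i) x₀)
    shift i = trans (iter-cong f-cong i _ _ (sym returns)) (reflexive (begin
      iter f i (iter f (suc N') x₀)  ≡⟨ iter-+ f i (suc N') x₀ ⟨
      iter f (i + suc N') x₀         ≡⟨ cong (λ t → iter f t x₀) (+-suc i N') ⟩
      iter f (suc (i + N')) x₀       ≡⟨ cong (λ t → iter f (suc t) x₀) (+-comm i N') ⟩
      iter f (suc (N' + i)) x₀       ≡⟨ cong (λ t → iter f t x₀) (+-suc N' i) ⟨
      iter f (N' + suc i) x₀         ≡⟨ iter-+ f N' (suc i) x₀ ⟩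
      iter f N' (iter f (suc i) x₀)  ∎))
      where open ≡-Reasoning

  module Cycle {f x₀ l} (f-cong : Respects≈ f) (cycle : IsCycle f x₀ l) where

    multiple-returns : ∀ q → iter f (q * l) x₀ ≈ x₀
    multiple-returns zero    = refl
    multiple-returns (suc q) =
      trans (reflexive (iter-+ f l (q * l) x₀)) (trans (iter-cong f-cong l _ _ (multiple-returns q)) (proj₂ cycle))

    divides⇒returns : ∀ t → l ∣ t → iter f t x₀ ≈ x₀
    divides⇒returns t (divides q t≡ql) = subst (λ s → iter f s x₀ ≈ x₀) (≡.sym t≡ql) (multiple-returns q)

    returns⇒divides : ∀ t → iter f t x₀ ≈ x₀ → l ∣ t
    returns⇒divides t returns = m%n≡0⇒n∣m t l (proj₁ (proj₁ cycle) (t % l) 0 (m%n<n t l) l>0 (trans (sym reduce) returns))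
      where
      l>0 = orbitSize-positive (proj₁ cycle)
      instance
        l≢0 : NonZero l
        l≢0 = >-nonZero l>0
      -- f^t x₀ = f^{t mod l}(f^{(t div l)·l} x₀) ≈ f^{t mod l} x₀
      reduce : iter f t x₀ ≈ iter f (t % l) x₀
      reduce = trans (reflexive (≡.trans (cong (λ s → iter f s x₀) (m≡m%n+[m/n]*n t l))
                                       (iter-+ f (t % l) ((t / l) * l) x₀)))
                     (iter-cong f-cong (t % l) _ _ (multiple-returns (t / l)))

  orbitSize-of-power : ∀ {f x₀ l l' m} → Respects≈ f → 0 < m →
                       OrbitSize f x₀ l → IsCycle (iter f m) x₀ l' →
                       l ≡ l' * gcd l m
  orbitSize-of-power {f} {x₀} {l} {l'} {m} f-cong m>0 orbit cycleᵐ@(orbitᵐ , closesᵐ) =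
    gcd-from-divisibility l l' m
      (λ t l'∣t → F.returns⇒divides (t * m) (trans (reflexive (≡.sym (iter-* f m t x₀))) (Fᵐ.divides⇒returns t l'∣t)))
      (λ t l∣tm → Fᵐ.returns⇒divides t (trans (reflexive (iter-* f m t x₀)) (F.divides⇒returns (t * m) l∣tm)))
    where
    l'm>0 : 0 < l' * m
    l'm>0 = >-nonZero⁻¹ (l' * m) {{m*n≢0 l' m {{>-nonZero (orbitSize-positive orbitᵐ)}} {{>-nonZero m>0}}}}
    -- f itself returns after l'·m steps, so its orbit is a cycle too
    closes : iter f l x₀ ≈ x₀
    closes = separating-orbit-closes
      (returning-orbit-separates f-cong l'm>0 (trans (reflexive (≡.sym (iter-* f m l' x₀))) closesᵐ)) orbit
    module F  = Cycle f-cong (orbit , closes)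
    module Fᵐ = Cycle (iter-cong f-cong m) cycleᵐ

parity : ∀ k → k % 2 ≡ 0 ⊎ k % 2 ≡ 1
parity k with k % 2 | m%n<n k 2
... | 0           | _ = inj₁ ≡.refl
... | 1           | _ = inj₂ ≡.refl
... | suc (suc _) | s≤s (s≤s ())

ψ-even : ∀ {o ℓ} (K : CommutativeRing o ℓ) a b k → k % 2 ≡ 0 → ∀ x → ψ K a b k x ≡ θabk K a b k x
ψ-even K a b k k-even x rewrite k-even = ≡.refl

ψ-odd : ∀ {o ℓ} (K : CommutativeRing o ℓ) a b k → k % 2 ≡ 1 → ∀ x → ψ K a b k x ≡ iter (θabk K a b k) 2 x
ψ-odd K a b k k-odd x rewrite k-odd = ≡.refl

mOf-even : ∀ k → k % 2 ≡ 0 → mOf k ≡ k / 2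
mOf-even k k-even rewrite k-even = ≡.refl

mOf-odd : ∀ k → k % 2 ≡ 1 → mOf k ≡ k
mOf-odd k k-odd rewrite k-odd = ≡.refl

mOf-positive : ∀ k → 2 ≤ k → 0 < mOf k
mOf-positive k k≥2 with parity k
... | inj₁ k-even = subst (0 <_) (≡.sym (mOf-even k k-even)) (m≥n⇒m/n>0 {k} {2} k≥2)
... | inj₂ k-odd  = subst (0 <_) (≡.sym (mOf-odd k k-odd)) (≤-trans (s≤s z≤n) k≥2)

power-agrees-with-ψ : ∀ {o ℓ p} (K : CommutativeRing o ℓ) (F : CommutativeRing.Carrier K → Set p) a b k (g : P1 K → P1 K) →
  (k % 2 ≡ 0 → ∀ x → InP1 K F x → _≈P_ K (iter g (k / 2) x) (θabk K a b k x)) →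
  (k % 2 ≡ 1 → ∀ x → InP1 K F x → _≈P_ K (iter g k x) (iter (θabk K a b k) 2 x)) →
  ∀ x → InP1 K F x → _≈P_ K (iter g (mOf k) x) (ψ K a b k x)
power-agrees-with-ψ K F a b k g even-case odd-case x Fx with parity k
... | inj₁ k-even = subst₂ (λ t u → _≈P_ K (iter g t x) u) (≡.sym (mOf-even k k-even)) (≡.sym (ψ-even K a b k k-even x))
                      (even-case k-even x Fx)
... | inj₂ k-odd  = subst₂ (λ t u → _≈P_ K (iter g t x) u) (≡.sym (mOf-odd k k-odd)) (≡.sym (ψ-odd K a b k k-odd x))
                      (odd-case k-odd x Fx)

module AffineFrobenius {o ℓ p} (K : CommutativeRing o ℓ) (F : CommutativeRing.Carrier K → Set p)
  (isField : IsField K) (char2 : CharTwo K) (subfield : IsSubfield K F)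
  (a b : CommutativeRing.Carrier K) (Fa : F a) (Fb : F b) (a≉0 : ¬ CommutativeRing._≈_ K a (CommutativeRing.0# K))
  (k : ℕ) where

  open ProjectiveLine K using (θ-preserves)
  open CharTwoField K isField char2 using (θabk-separates)

  θabk-preserves : ∀ x → InP1 K F x → InP1 K F (θabk K a b k x)
  θabk-preserves = θ-preserves subfield (2 ^ k) Fa Fb

  ψ-preserves : ∀ x → InP1 K F x → InP1 K F (ψ K a b k x)
  ψ-preserves x Fx with parity k
  ... | inj₁ k-even = subst (InP1 K F) (≡.sym (ψ-even K a b k k-even x)) (θabk-preserves x Fx)
  ... | inj₂ k-odd  = subst (InP1 K F) (≡.sym (ψ-odd K a b k k-odd x)) (θabk-preserves (θabk K a b k x) (θabk-preserves x Fx))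

  θ-separates : ∀ x y → ¬ _≈P_ K x y → ¬ _≈P_ K (θabk K a b k x) (θabk K a b k y)
  θ-separates = θabk-separates a b k a≉0

  ψ-separates : ∀ x y → ¬ _≈P_ K x y → ¬ _≈P_ K (ψ K a b k x) (ψ K a b k y)
  ψ-separates x y x≉y with parity k
  ... | inj₁ k-even = subst₂ (λ u v → ¬ _≈P_ K u v) (≡.sym (ψ-even K a b k k-even x)) (≡.sym (ψ-even K a b k k-even y))
                        (θ-separates x y x≉y)
  ... | inj₂ k-odd  = subst₂ (λ u v → ¬ _≈P_ K u v) (≡.sym (ψ-odd K a b k k-odd x)) (≡.sym (ψ-odd K a b k k-odd y))
                        (θ-separates (θabk K a b k x) (θabk K a b k y) (θ-separates x y x≉y))

lemma4p4 : ∀ {o ℓ p} (K : CommutativeRing o ℓ) (F : CommutativeRing.Carrier K → Set p)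
    (n : ℕ) → 1 ≤ n → IsAlgClosureOfF2n K F n →
    (k : ℕ) → 2 ≤ k →
    (a b : CommutativeRing.Carrier K) → F a → F b → ¬ (CommutativeRing._≈_ K a (CommutativeRing.0# K)) →
    (c d : CommutativeRing.Carrier K) →
    (k % 2 ≡ 0 → ∀ x → InP1 K F x → _≈P_ K (iter (θcd K c d) (k / 2) x) (θabk K a b k x)) →
    (k % 2 ≡ 1 → ∀ x → InP1 K F x → _≈P_ K (iter (θcd K c d) k x) (iter (θabk K a b k) 2 x)) →
    (x₀ : P1 K) → InP1 K F x₀ →
    (l₁ l₂ l₃ : ℕ) →
    OrbitCard K (θcd K c d) x₀ l₁ →
    OrbitCard K (θabk K a b k) x₀ l₂ →
    OrbitCard K (ψ K a b k) x₀ l₃ →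
    (l₁ ≡ l₃ * gcd l₁ (mOf k))
    × (k % 2 ≡ 0 → l₂ ≡ l₃)
    × (k % 2 ≡ 1 → (l₂ ≡ l₃) ⊎ (l₂ ≡ 2 * l₃))
lemma4p4 K F _ _ (isField , char2 , subfield , _) k k≥2 a b Fa Fb a≉0 c d even-case odd-case
         x₀ Fx₀ l₁ l₂ l₃ orbit₁ orbit₂ orbit₃ =
  part₁ , part₂ , part₃
  where
  open ProjectiveLine K
  open Orbits P1-setoid
  open AffineFrobenius K F isField char2 subfield a b Fa Fb a≉0 k
  open Setoid P1-setoid using (reflexive)

  -- ψ keeps distinct points distinct, so its orbit through x₀ is a cycle
  ψ-cycle : IsCycle (ψ K a b k) x₀ l₃
  ψ-cycle = orbit₃ , separating-orbit-closes {f = ψ K a b k} (λ i j → ψ-separates _ _) orbit₃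

  -- on P¹(F), θ_{c,d}^m agrees with ψ, so the ψ-orbit of x₀ is its θ_{c,d}^m-orbit
  ψ≈θcd^m : ∀ i → _≈P_ K (iter (ψ K a b k) i x₀) (iter (iter (θcd K c d) (mOf k)) i x₀)
  ψ≈θcd^m = iterates-agree {P = InP1 K F} (iter-cong {f = θcd K c d} (θ-cong c d 4) (mOf k)) ψ-preserves
              (power-agrees-with-ψ K F a b k (θcd K c d) even-case odd-case) Fx₀

  part₁ : l₁ ≡ l₃ * gcd l₁ (mOf k)
  part₁ = orbitSize-of-power {f = θcd K c d} (θ-cong c d 4) (mOf-positive k k≥2) orbit₁ (cycle-transport ψ≈θcd^m ψ-cycle)

  part₂ : k % 2 ≡ 0 → l₂ ≡ l₃
  part₂ k-even = orbitSize-unique orbit₂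
    (orbitSize-transport (λ i → reflexive (iter-≗ (ψ-even K a b k k-even) i x₀)) orbit₃)

  part₃ : k % 2 ≡ 1 → (l₂ ≡ l₃) ⊎ (l₂ ≡ 2 * l₃)
  part₃ k-odd = gcd-with-2 l₂ l₃
    (orbitSize-of-power {f = θabk K a b k} (θ-cong a b (2 ^ k)) (s≤s z≤n) orbit₂ (cycle-transport ψ≈θ² ψ-cycle))
    where
    ψ≈θ² : ∀ i → _≈P_ K (iter (ψ K a b k) i x₀) (iter (iter (θabk K a b k) 2) i x₀)
    ψ≈θ² i = reflexive (iter-≗ (ψ-odd K a b k k-odd) i x₀)
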